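{- Let $(M,P,S)$ and $(L,R,T)$ be perfect structures, where $M$ (order $n_1$) and $L$ (order $n_2$) are the adjacency matrices of graphs $G$ and $H$, $S$ has order $k_1$ and $T$ has order $k_2$. Then $P\otimes R$ is a perfect structure in the normal product $G\boxtimes H$, whose adjacency matrix is $M\otimes I_{n_2}+I_{n_1}\otimes L+M\otimes L$, with parameter matrix $I_{k_1}\otimes T+S\otimes I_{k_2}+S\otimes T$.
   Context: A perfect structure is a triple $(M,P,S)$ of complex matrices with $MP=PS$, where $M$ is a diagonalizable square matrix of order $n$, $P$ is an $n\times k$ matrix with $k\le n$, and $S$ is a $k\times k$ matrix. $\otimes$ is the Kronecker product and $I_r$ the identity matrix of order $r$. -}

module Defs where

open import Level using (Level)
open import Data.Nat as ℕ using (ℕ; zero; suc; _≤_)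
open import Data.Fin as F using (Fin; zero; suc; remQuot)
open import Data.Fin.Properties using (_≟_)
open import Data.Bool using (Bool; true; false; _∧_; _∨_; if_then_else_)
open import Data.Bool.Properties using (∨-comm)
open import Data.Product using (Σ; _×_; _,_; proj₁; proj₂; ∃-syntax)
open import Relation.Nullary using (yes; no)
open import Relation.Nullary.Decidable using (⌊_⌋)
open import Relation.Binary.PropositionalEquality
  using (_≡_; refl; sym; cong₂)
open import Algebra.Bundles using (CommutativeRing)
open import Data.Empty using (⊥-elim)

record Graph (n : ℕ) : Set where
  field
    adj   : Fin n → Fin n → Bool
    adj-sym   : ∀ i j → adj i j ≡ adj j i
    adj-irref : ∀ i → adj i i ≡ false
open Graph public

_=ᶠ_ : ∀ {n} → Fin n → Fin n → Bool
i =ᶠ j = ⌊ i ≟ j ⌋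

=ᶠ-sym : ∀ {n} (i j : Fin n) → (i =ᶠ j) ≡ (j =ᶠ i)
=ᶠ-sym i j with i ≟ j | j ≟ i
... | yes _ | yes _ = refl
... | no  _ | no  _ = refl
... | yes p | no ¬q = ⊥-elim (¬q (sym p))
... | no ¬p | yes q = ⊥-elim (¬p (sym q))

=ᶠ-refl : ∀ {n} (i : Fin n) → (i =ᶠ i) ≡ true
=ᶠ-refl i with i ≟ i
... | yes _ = refl
... | no ¬p = ⊥-elim (¬p refl)

-- Vertex (i , j) of G ⊠ H (i ∈ V(G), j ∈ V(H)) is encoded as
-- F.combine i j : Fin (n₁ * n₂), i.e. index i·n₂ + j; remQuot decodes it.
normalAdj² : ∀ {n₁ n₂} → Graph n₁ → Graph n₂ →
             Fin n₁ × Fin n₂ → Fin n₁ × Fin n₂ → Bool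
normalAdj² G H (i , j) (i' , j') =
  ((i =ᶠ i') ∧ adj H j j') ∨ (adj G i i' ∧ (j =ᶠ j')) ∨ (adj G i i' ∧ adj H j j')

normalAdj²-sym : ∀ {n₁ n₂} (G : Graph n₁) (H : Graph n₂) u v →
                 normalAdj² G H u v ≡ normalAdj² G H v u
normalAdj²-sym G H (i , j) (i' , j')
  rewrite =ᶠ-sym i i' | =ᶠ-sym j j' | adj-sym G i i' | adj-sym H j j' = refl

normalAdj²-irref : ∀ {n₁ n₂} (G : Graph n₁) (H : Graph n₂) u →
                   normalAdj² G H u u ≡ false
normalAdj²-irref G H (i , j) rewrite adj-irref G i | adj-irref H j with i =ᶠ i | j =ᶠ j
... | false | false = refl
... | false | true = refl
... | true | false = refl
... | true | true = refl

normalAdj : ∀ {n₁ n₂} → Graph n₁ → Graph n₂ →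
            Fin (n₁ ℕ.* n₂) → Fin (n₁ ℕ.* n₂) → Bool
normalAdj {n₁} {n₂} G H x y = normalAdj² G H (remQuot {n₁} n₂ x) (remQuot {n₁} n₂ y)

_⊠_ : ∀ {n₁ n₂} → Graph n₁ → Graph n₂ → Graph (n₁ ℕ.* n₂)
_⊠_ {n₁} {n₂} G H = record
  { adj = normalAdj G H
  ; adj-sym = λ x y → normalAdj²-sym G H (remQuot {n₁} n₂ x) (remQuot {n₁} n₂ y)
  ; adj-irref = λ x → normalAdj²-irref G H (remQuot {n₁} n₂ x)
  }

module Matrices {c ℓ : Level} (𝕂 : CommutativeRing c ℓ) where
  open CommutativeRing 𝕂 using (Carrier; _≈_; _+_; _*_; 0#; 1#)

  Mat : ℕ → ℕ → Set c
  Mat m n = Fin m → Fin n → Carrier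

  _≈ᴹ_ : ∀ {m n} → Mat m n → Mat m n → Set ℓ
  A ≈ᴹ B = ∀ i j → A i j ≈ B i j

  Σᶠ : ∀ n → (Fin n → Carrier) → Carrier
  Σᶠ zero    f = 0#
  Σᶠ (suc n) f = f zero + Σᶠ n (λ i → f (suc i))

  _⊡_ : ∀ {m n p} → Mat m n → Mat n p → Mat m p
  _⊡_ {n = n} A B i k = Σᶠ n (λ j → A i j * B j k)

  _⊞_ : ∀ {m n} → Mat m n → Mat m n → Mat m n
  (A ⊞ B) i j = A i j + B i j

  I : ∀ n → Mat n n
  I n i j = if i =ᶠ j then 1# else 0#

  -- Kronecker product: (A ⊗ B)_{(i,j),(i',j')} = A_{i i'} B_{j j'}
  -- with (i,j) ↦ i·(rows of B) + j (the standard convention).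
  _⊗_ : ∀ {m₁ n₁ m₂ n₂} → Mat m₁ n₁ → Mat m₂ n₂ → Mat (m₁ ℕ.* m₂) (n₁ ℕ.* n₂)
  _⊗_ {m₁} {n₁} {m₂} {n₂} A B x y =
    A (proj₁ (remQuot {m₁} m₂ x)) (proj₁ (remQuot {n₁} n₂ y)) *
    B (proj₂ (remQuot {m₁} m₂ x)) (proj₂ (remQuot {n₁} n₂ y))

  adjMat : ∀ {n} → Graph n → Mat n n
  adjMat G i j = if adj G i j then 1# else 0#

  IsDiagonal : ∀ {n} → Mat n n → Set ℓ
  IsDiagonal {n} D = ∀ i j → (i =ᶠ j) ≡ false → D i j ≈ 0#

  Diagonalizable : ∀ {n} → Mat n n → Set (c Level.⊔ ℓ)
  Diagonalizable {n} M =
    ∃[ Q ] ∃[ Q⁻¹ ] ∃[ D ]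
      ((Q ⊡ Q⁻¹) ≈ᴹ I n × (Q⁻¹ ⊡ Q) ≈ᴹ I n × IsDiagonal D ×
       M ≈ᴹ ((Q ⊡ D) ⊡ Q⁻¹))

  PerfectStructure : ∀ {n k} → Mat n n → Mat n k → Mat k k → Set (c Level.⊔ ℓ)
  PerfectStructure {n} {k} M P S =
    Diagonalizable M × k ≤ n × (M ⊡ P) ≈ᴹ (P ⊡ S)

module Submission where

-- Over an arbitrary commutative ring, using the mixed-product rule
-- (A ⊗ B)(C ⊗ D) = AC ⊗ BD, we show that normalᴹ preserves
--   * diagonalizability: conjugation by Q₁ ⊗ Q₂ commutes with normalᴹ,
--     and normalᴹ of diagonal matrices is diagonal;
--   * intertwining: AP = PS and BR = RT give
--     normalᴹ A B (P ⊗ R) = (P ⊗ R) normalᴹ S T;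
-- hence perfect structures (PerfectStructure-normal).  Separately, the
-- adjacency matrix of G ⊠ H equals normalᴹ (adjMat G) (adjMat H), because
-- irreflexivity makes the three adjacency cases mutually exclusive
-- (adjMat-⊠).

open import Defs
open import Level using (Level)
open import Data.Nat using (ℕ)
open ℕ using (zero; suc)
open import Data.Product using (_×_; _,_; proj₁; proj₂; uncurry)
open import Algebra.Bundles using (CommutativeRing)

import Data.Nat as ℕ
open import Data.Nat.Properties using (*-mono-≤)
open import Data.Fin using (Fin; zero; suc; remQuot; combine; _↑ˡ_; _↑ʳ_)
open import Data.Fin.Properties using (_≟_; remQuot-combine; combine-remQuot)
open import Data.Bool using (Bool; true; false; _∧_; _∨_; if_then_else_)
open import Data.Bool.Properties using (∧-identityʳ; ∧-zeroʳ)
open import Relation.Nullary using (yes; no)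
open import Relation.Binary.PropositionalEquality as ≡ using (_≡_)
open import Relation.Binary.Bundles using (Setoid)
import Algebra.Properties.CommutativeSemigroup as CommSemigroupProperties
import Algebra.Properties.Semiring.Sum as SemiringSum
import Relation.Binary.Reasoning.Setoid as SetoidReasoning

=ᶠ⇒≡ : ∀ {n} {i j : Fin n} → (i =ᶠ j) ≡ true → i ≡ j
=ᶠ⇒≡ {i = i} {j} e with i ≟ j
... | yes i≡j = i≡j

=ᶠ-suc : ∀ {n} (i j : Fin n) → (suc i =ᶠ suc j) ≡ (i =ᶠ j)
=ᶠ-suc i j with i ≟ j
... | yes _ = ≡.refl
... | no _  = ≡.refl

remQuot-injective : ∀ m n {x y : Fin (m ℕ.* n)} →
                    remQuot {m} n x ≡ remQuot {m} n y → x ≡ y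
remQuot-injective m n {x} {y} e = ≡.trans (≡.sym (combine-remQuot {m} n x))
  (≡.trans (≡.cong (uncurry combine) e) (combine-remQuot {m} n y))

adj-∧-=ᶠ : ∀ {n} (G : Graph n) (i j : Fin n) → adj G i j ∧ (i =ᶠ j) ≡ false
adj-∧-=ᶠ G i j with i ≟ j
... | yes ≡.refl = ≡.trans (∧-identityʳ (adj G i i)) (adj-irref G i)
... | no _       = ∧-zeroʳ (adj G i j)

module Kronecker {c ℓ : Level} (𝕂 : CommutativeRing c ℓ) where
  open CommutativeRing 𝕂 hiding (zero)
  open Matrices 𝕂
  open SemiringSum semiring
    using (sum; sum-cong-≋; sum-replicate-zero; ∑-distrib-+; *-distribˡ-sum; *-distribʳ-sum)
  open CommSemigroupProperties *-commutativeSemigroup using (interchange)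

  ite : Bool → Carrier
  ite b = if b then 1# else 0#

  Σᶠ≡sum : ∀ n (f : Fin n → Carrier) → Σᶠ n f ≡ sum f
  Σᶠ≡sum zero    f = ≡.refl
  Σᶠ≡sum (suc n) f = ≡.cong (f zero +_) (Σᶠ≡sum n (λ i → f (suc i)))

  Σᶠ-cong : ∀ n {f g : Fin n → Carrier} → (∀ i → f i ≈ g i) → Σᶠ n f ≈ Σᶠ n g
  Σᶠ-cong n {f} {g} f≈g rewrite Σᶠ≡sum n f | Σᶠ≡sum n g = sum-cong-≋ f≈g

  Σᶠ-zero : ∀ n → Σᶠ n (λ _ → 0#) ≈ 0#
  Σᶠ-zero n rewrite Σᶠ≡sum n (λ _ → 0#) = sum-replicate-zero n

  Σᶠ-+ : ∀ n (f g : Fin n → Carrier) → Σᶠ n (λ i → f i + g i) ≈ Σᶠ n f + Σᶠ n g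
  Σᶠ-+ n f g rewrite Σᶠ≡sum n (λ i → f i + g i) | Σᶠ≡sum n f | Σᶠ≡sum n g =
    ∑-distrib-+ f g

  Σᶠ-*ˡ : ∀ n a (f : Fin n → Carrier) → a * Σᶠ n f ≈ Σᶠ n (λ i → a * f i)
  Σᶠ-*ˡ n a f rewrite Σᶠ≡sum n f | Σᶠ≡sum n (λ i → a * f i) = *-distribˡ-sum a f

  Σᶠ-*ʳ : ∀ n a (f : Fin n → Carrier) → Σᶠ n f * a ≈ Σᶠ n (λ i → f i * a)
  Σᶠ-*ʳ n a f rewrite Σᶠ≡sum n f | Σᶠ≡sum n (λ i → f i * a) = *-distribʳ-sum a f

  Σᶠ-++ : ∀ m k (f : Fin (m ℕ.+ k) → Carrier) →
          Σᶠ (m ℕ.+ k) f ≈ Σᶠ m (λ i → f (i ↑ˡ k)) + Σᶠ k (λ i → f (m ↑ʳ i))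
  Σᶠ-++ zero    k f = sym (+-identityˡ _)
  Σᶠ-++ (suc m) k f = trans (+-cong refl (Σᶠ-++ m k _)) (sym (+-assoc _ _ _))

  Σᶠ-combine : ∀ m n (f : Fin (m ℕ.* n) → Carrier) →
               Σᶠ (m ℕ.* n) f ≈ Σᶠ m (λ i → Σᶠ n (λ j → f (combine i j)))
  Σᶠ-combine zero    n f = refl
  Σᶠ-combine (suc m) n f = trans (Σᶠ-++ n (m ℕ.* n) f) (+-cong refl (Σᶠ-combine m n _))

  Σᶠ-δ : ∀ n (i : Fin n) (f : Fin n → Carrier) → Σᶠ n (λ j → I n i j * f j) ≈ f i
  Σᶠ-δ (suc n) zero f = trans
    (+-cong (*-identityˡ _) (trans (Σᶠ-cong n (λ j → zeroˡ _)) (Σᶠ-zero n)))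
    (+-identityʳ _)
  Σᶠ-δ (suc n) (suc i) f = trans
    (+-cong (zeroˡ _) (trans (Σᶠ-cong n (λ j → *-cong (reflexive (≡.cong ite (=ᶠ-suc i j))) refl))
                             (Σᶠ-δ n i (λ j → f (suc j)))))
    (+-identityˡ _)

  Σᶠ-δʳ : ∀ n (i : Fin n) (f : Fin n → Carrier) → Σᶠ n (λ j → f j * I n j i) ≈ f i
  Σᶠ-δʳ n i f = trans
    (Σᶠ-cong n (λ j → trans (*-comm _ _) (*-cong (reflexive (≡.cong ite (=ᶠ-sym j i))) refl)))
    (Σᶠ-δ n i f)

  ≈ᴹ-refl : ∀ {m n} {A : Mat m n} → A ≈ᴹ A
  ≈ᴹ-refl i j = refl

  ≈ᴹ-sym : ∀ {m n} {A B : Mat m n} → A ≈ᴹ B → B ≈ᴹ A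
  ≈ᴹ-sym A≈B i j = sym (A≈B i j)

  ≈ᴹ-trans : ∀ {m n} {A B C : Mat m n} → A ≈ᴹ B → B ≈ᴹ C → A ≈ᴹ C
  ≈ᴹ-trans A≈B B≈C i j = trans (A≈B i j) (B≈C i j)

  Mat-setoid : ℕ → ℕ → Setoid c ℓ
  Mat-setoid m n = record
    { Carrier = Mat m n
    ; _≈_ = _≈ᴹ_
    ; isEquivalence = record { refl = ≈ᴹ-refl ; sym = ≈ᴹ-sym ; trans = ≈ᴹ-trans }
    }

  ⊞-cong : ∀ {m n} {A A' B B' : Mat m n} → A ≈ᴹ A' → B ≈ᴹ B' → (A ⊞ B) ≈ᴹ (A' ⊞ B')
  ⊞-cong A≈A' B≈B' i j = +-cong (A≈A' i j) (B≈B' i j)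

  ⊞-comm : ∀ {m n} (A B : Mat m n) → (A ⊞ B) ≈ᴹ (B ⊞ A)
  ⊞-comm A B i j = +-comm _ _

  ⊡-cong : ∀ {m n p} {A A' : Mat m n} {B B' : Mat n p} →
           A ≈ᴹ A' → B ≈ᴹ B' → (A ⊡ B) ≈ᴹ (A' ⊡ B')
  ⊡-cong {n = n} A≈A' B≈B' i k = Σᶠ-cong n (λ j → *-cong (A≈A' i j) (B≈B' j k))

  ⊗-cong : ∀ {m₁ n₁ m₂ n₂} {A A' : Mat m₁ n₁} {B B' : Mat m₂ n₂} →
           A ≈ᴹ A' → B ≈ᴹ B' → (A ⊗ B) ≈ᴹ (A' ⊗ B')
  ⊗-cong A≈A' B≈B' x y = *-cong (A≈A' _ _) (B≈B' _ _)

  ⊡-distribˡ : ∀ {m n p} (A : Mat m n) (B C : Mat n p) →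
               (A ⊡ (B ⊞ C)) ≈ᴹ ((A ⊡ B) ⊞ (A ⊡ C))
  ⊡-distribˡ {n = n} A B C i k = trans (Σᶠ-cong n (λ j → distribˡ _ _ _)) (Σᶠ-+ n _ _)

  ⊡-distribʳ : ∀ {m n p} (A B : Mat m n) (C : Mat n p) →
               ((A ⊞ B) ⊡ C) ≈ᴹ ((A ⊡ C) ⊞ (B ⊡ C))
  ⊡-distribʳ {n = n} A B C i k = trans (Σᶠ-cong n (λ j → distribʳ _ _ _)) (Σᶠ-+ n _ _)

  ⊡-identityˡ : ∀ {m n} (A : Mat m n) → (I m ⊡ A) ≈ᴹ A
  ⊡-identityˡ {m} A i k = Σᶠ-δ m i (λ j → A j k)

  ⊡-identityʳ : ∀ {m n} (A : Mat m n) → (A ⊡ I n) ≈ᴹ A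
  ⊡-identityʳ {n = n} A i k = Σᶠ-δʳ n k (A i)

  ⊗-⊡ : ∀ {m₁ n₁ p₁ m₂ n₂ p₂}
        (A : Mat m₁ n₁) (B : Mat m₂ n₂) (C : Mat n₁ p₁) (D : Mat n₂ p₂) →
        ((A ⊗ B) ⊡ (C ⊗ D)) ≈ᴹ ((A ⊡ C) ⊗ (B ⊡ D))
  ⊗-⊡ {m₁} {n₁} {p₁} {m₂} {n₂} {p₂} A B C D x z = begin
      Σᶠ (n₁ ℕ.* n₂) (λ y → term (remQuot {n₁} n₂ y))
    ≈⟨ Σᶠ-combine n₁ n₂ _ ⟩
      Σᶠ n₁ (λ a → Σᶠ n₂ (λ b → term (remQuot {n₁} n₂ (combine a b))))
    ≈⟨ Σᶠ-cong n₁ (λ a → Σᶠ-cong n₂ (λ b →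
         trans (reflexive (≡.cong term (remQuot-combine a b))) (interchange _ _ _ _))) ⟩
      Σᶠ n₁ (λ a → Σᶠ n₂ (λ b → (A i a * C a k) * (B j b * D b l)))
    ≈⟨ Σᶠ-cong n₁ (λ a → sym (Σᶠ-*ˡ n₂ _ _)) ⟩
      Σᶠ n₁ (λ a → (A i a * C a k) * Σᶠ n₂ (λ b → B j b * D b l))
    ≈⟨ sym (Σᶠ-*ʳ n₁ _ _) ⟩
      Σᶠ n₁ (λ a → A i a * C a k) * Σᶠ n₂ (λ b → B j b * D b l) ∎
    where
      open SetoidReasoning setoid
      i = proj₁ (remQuot {m₁} m₂ x)
      j = proj₂ (remQuot {m₁} m₂ x)
      k = proj₁ (remQuot {p₁} p₂ z)
      l = proj₂ (remQuot {p₁} p₂ z)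
      term : Fin n₁ × Fin n₂ → Carrier
      term (a , b) = (A i a * B j b) * (C a k * D b l)

  IsDiagonal-I : ∀ n → IsDiagonal (I n)
  IsDiagonal-I n i j i≠j = reflexive (≡.cong ite i≠j)

  IsDiagonal-⊞ : ∀ {n} {D E : Mat n n} → IsDiagonal D → IsDiagonal E → IsDiagonal (D ⊞ E)
  IsDiagonal-⊞ dD dE i j i≠j = trans (+-cong (dD i j i≠j) (dE i j i≠j)) (+-identityʳ 0#)

  -- An off-diagonal product index differs in one of its two coordinates.
  IsDiagonal-⊗ : ∀ {m n} {D : Mat m m} {E : Mat n n} →
                 IsDiagonal D → IsDiagonal E → IsDiagonal (D ⊗ E)
  IsDiagonal-⊗ {m} {n} dD dE x y x≠y
    with proj₁ (remQuot {m} n x) =ᶠ proj₁ (remQuot {m} n y) in e₁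
       | proj₂ (remQuot {m} n x) =ᶠ proj₂ (remQuot {m} n y) in e₂
  ... | false | _     = trans (*-cong (dD _ _ e₁) refl) (zeroˡ _)
  ... | true  | false = trans (*-cong refl (dE _ _ e₂)) (zeroʳ _)
  ... | true  | true
    with ≡.refl ← remQuot-injective m n (≡.cong₂ _,_ (=ᶠ⇒≡ e₁) (=ᶠ⇒≡ e₂))
    with () ← ≡.trans (≡.sym x≠y) (=ᶠ-refl x)

  I⊗I : ∀ m n → (I m ⊗ I n) ≈ᴹ I (m ℕ.* n)
  I⊗I m n x y with x =ᶠ y in e
  ... | false = IsDiagonal-⊗ (IsDiagonal-I m) (IsDiagonal-I n) x y e
  ... | true with ≡.refl ← =ᶠ⇒≡ e =
    trans (*-cong (reflexive (≡.cong ite (=ᶠ-refl _))) (reflexive (≡.cong ite (=ᶠ-refl _))))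
          (*-identityˡ 1#)

  ⊗-inverse : ∀ {n₁ n₂} {Q₁ Q₁' : Mat n₁ n₁} {Q₂ Q₂' : Mat n₂ n₂} →
              (Q₁ ⊡ Q₁') ≈ᴹ I n₁ → (Q₂ ⊡ Q₂') ≈ᴹ I n₂ →
              ((Q₁ ⊗ Q₂) ⊡ (Q₁' ⊗ Q₂')) ≈ᴹ I (n₁ ℕ.* n₂)
  ⊗-inverse {n₁} {n₂} {Q₁} {Q₁'} {Q₂} {Q₂'} inv₁ inv₂ =
    ≈ᴹ-trans (⊗-⊡ Q₁ Q₂ Q₁' Q₂') (≈ᴹ-trans (⊗-cong inv₁ inv₂) (I⊗I n₁ n₂))

  normalᴹ : ∀ {m n} → Mat m m → Mat n n → Mat (m ℕ.* n) (m ℕ.* n)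
  normalᴹ {m} {n} A B = ((A ⊗ I n) ⊞ (I m ⊗ B)) ⊞ (A ⊗ B)

  normalᴹ-cong : ∀ {m n} {A A' : Mat m m} {B B' : Mat n n} →
                 A ≈ᴹ A' → B ≈ᴹ B' → normalᴹ A B ≈ᴹ normalᴹ A' B'
  normalᴹ-cong {m} {n} A≈A' B≈B' =
    ⊞-cong (⊞-cong (⊗-cong A≈A' (≈ᴹ-refl {A = I n})) (⊗-cong (≈ᴹ-refl {A = I m}) B≈B'))
           (⊗-cong A≈A' B≈B')

  -- The theorem lists the first two summands of the parameter matrix in the other order.
  normalᴹ-swap : ∀ {m n} (S : Mat m m) (T : Mat n n) →
                 normalᴹ S T ≈ᴹ (((I m ⊗ T) ⊞ (S ⊗ I n)) ⊞ (S ⊗ T))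
  normalᴹ-swap {m} {n} S T = ⊞-cong (⊞-comm (S ⊗ I n) (I m ⊗ T)) ≈ᴹ-refl

  IsDiagonal-normal : ∀ {m n} {D : Mat m m} {E : Mat n n} →
                      IsDiagonal D → IsDiagonal E → IsDiagonal (normalᴹ D E)
  IsDiagonal-normal {m} {n} dD dE = IsDiagonal-⊞
    (IsDiagonal-⊞ (IsDiagonal-⊗ dD (IsDiagonal-I n)) (IsDiagonal-⊗ (IsDiagonal-I m) dE))
    (IsDiagonal-⊗ dD dE)

  conj : ∀ {n} → Mat n n → Mat n n → Mat n n → Mat n n
  conj Q Q' X = (Q ⊡ X) ⊡ Q'

  conj-⊞ : ∀ {n} (Q Q' X Y : Mat n n) → conj Q Q' (X ⊞ Y) ≈ᴹ (conj Q Q' X ⊞ conj Q Q' Y)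
  conj-⊞ Q Q' X Y = ≈ᴹ-trans (⊡-cong (⊡-distribˡ Q X Y) ≈ᴹ-refl) (⊡-distribʳ _ _ Q')

  conj-⊗ : ∀ {n₁ n₂} (Q₁ Q₁' X : Mat n₁ n₁) (Q₂ Q₂' Y : Mat n₂ n₂) →
           conj (Q₁ ⊗ Q₂) (Q₁' ⊗ Q₂') (X ⊗ Y) ≈ᴹ (conj Q₁ Q₁' X ⊗ conj Q₂ Q₂' Y)
  conj-⊗ Q₁ Q₁' X Q₂ Q₂' Y =
    ≈ᴹ-trans (⊡-cong (⊗-⊡ Q₁ Q₂ X Y) ≈ᴹ-refl) (⊗-⊡ (Q₁ ⊡ X) (Q₂ ⊡ Y) Q₁' Q₂')

  conj-I : ∀ {n} {Q Q' : Mat n n} → (Q ⊡ Q') ≈ᴹ I n → conj Q Q' (I n) ≈ᴹ I n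
  conj-I {Q = Q} inv = ≈ᴹ-trans (⊡-cong (⊡-identityʳ Q) ≈ᴹ-refl) inv

  conj-normal : ∀ {n₁ n₂} {Q₁ Q₁' : Mat n₁ n₁} {Q₂ Q₂' : Mat n₂ n₂} (X : Mat n₁ n₁) (Y : Mat n₂ n₂) →
                (Q₁ ⊡ Q₁') ≈ᴹ I n₁ → (Q₂ ⊡ Q₂') ≈ᴹ I n₂ →
                conj (Q₁ ⊗ Q₂) (Q₁' ⊗ Q₂') (normalᴹ X Y) ≈ᴹ normalᴹ (conj Q₁ Q₁' X) (conj Q₂ Q₂' Y)
  conj-normal {n₁} {n₂} {Q₁} {Q₁'} {Q₂} {Q₂'} X Y inv₁ inv₂ = begin
      conj Q Q' (normalᴹ X Y)
    ≈⟨ ≈ᴹ-trans (conj-⊞ Q Q' _ _) (⊞-cong (conj-⊞ Q Q' _ _) ≈ᴹ-refl) ⟩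
      (conj Q Q' (X ⊗ I n₂) ⊞ conj Q Q' (I n₁ ⊗ Y)) ⊞ conj Q Q' (X ⊗ Y)
    ≈⟨ ⊞-cong (⊞-cong (conj-⊗ Q₁ Q₁' X Q₂ Q₂' (I n₂)) (conj-⊗ Q₁ Q₁' (I n₁) Q₂ Q₂' Y))
              (conj-⊗ Q₁ Q₁' X Q₂ Q₂' Y) ⟩
      ((conj Q₁ Q₁' X ⊗ conj Q₂ Q₂' (I n₂)) ⊞ (conj Q₁ Q₁' (I n₁) ⊗ conj Q₂ Q₂' Y))
        ⊞ (conj Q₁ Q₁' X ⊗ conj Q₂ Q₂' Y)
    ≈⟨ ⊞-cong (⊞-cong (⊗-cong (≈ᴹ-refl {A = conj Q₁ Q₁' X}) (conj-I inv₂))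
                      (⊗-cong (conj-I inv₁) (≈ᴹ-refl {A = conj Q₂ Q₂' Y})))
              ≈ᴹ-refl ⟩
      normalᴹ (conj Q₁ Q₁' X) (conj Q₂ Q₂' Y) ∎
    where
      open SetoidReasoning (Mat-setoid (n₁ ℕ.* n₂) (n₁ ℕ.* n₂))
      Q = Q₁ ⊗ Q₂
      Q' = Q₁' ⊗ Q₂'

  Diagonalizable-resp : ∀ {n} {A B : Mat n n} → A ≈ᴹ B → Diagonalizable A → Diagonalizable B
  Diagonalizable-resp A≈B (Q , Q' , D , inv , inv' , dD , A≈QDQ') =
    Q , Q' , D , inv , inv' , dD , ≈ᴹ-trans (≈ᴹ-sym A≈B) A≈QDQ'

  Diagonalizable-normal : ∀ {m n} {A : Mat m m} {B : Mat n n} →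
                          Diagonalizable A → Diagonalizable B → Diagonalizable (normalᴹ A B)
  Diagonalizable-normal (Q₁ , Q₁' , D₁ , inv₁ , inv₁' , dD₁ , A≈)
                        (Q₂ , Q₂' , D₂ , inv₂ , inv₂' , dD₂ , B≈) =
    Q₁ ⊗ Q₂ , Q₁' ⊗ Q₂' , normalᴹ D₁ D₂ ,
    ⊗-inverse inv₁ inv₂ , ⊗-inverse inv₁' inv₂' , IsDiagonal-normal dD₁ dD₂ ,
    ≈ᴹ-trans (normalᴹ-cong A≈ B≈) (≈ᴹ-sym (conj-normal D₁ D₂ inv₁ inv₂))

  Intertwines : ∀ {n k} → Mat n n → Mat n k → Mat k k → Set ℓ
  Intertwines A P S = (A ⊡ P) ≈ᴹ (P ⊡ S)

  intertwines-I : ∀ {n k} (P : Mat n k) → Intertwines (I n) P (I k)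
  intertwines-I P = ≈ᴹ-trans (⊡-identityˡ P) (≈ᴹ-sym (⊡-identityʳ P))

  intertwines-⊞ : ∀ {n k} {A B : Mat n n} {P : Mat n k} {S T : Mat k k} →
                  Intertwines A P S → Intertwines B P T → Intertwines (A ⊞ B) P (S ⊞ T)
  intertwines-⊞ {A = A} {B} {P} {S} {T} AP≈PS BP≈PT =
    ≈ᴹ-trans (⊡-distribʳ A B P)
      (≈ᴹ-trans (⊞-cong AP≈PS BP≈PT) (≈ᴹ-sym (⊡-distribˡ P S T)))

  intertwines-⊗ : ∀ {n₁ k₁ n₂ k₂} {A : Mat n₁ n₁} {P : Mat n₁ k₁} {S : Mat k₁ k₁}
                  {B : Mat n₂ n₂} {R : Mat n₂ k₂} {T : Mat k₂ k₂} →
                  Intertwines A P S → Intertwines B R T → Intertwines (A ⊗ B) (P ⊗ R) (S ⊗ T)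
  intertwines-⊗ {A = A} {P} {S} {B} {R} {T} AP≈PS BR≈RT =
    ≈ᴹ-trans (⊗-⊡ A B P R) (≈ᴹ-trans (⊗-cong AP≈PS BR≈RT) (≈ᴹ-sym (⊗-⊡ P R S T)))

  intertwines-normal : ∀ {n₁ k₁ n₂ k₂} {A : Mat n₁ n₁} {P : Mat n₁ k₁} {S : Mat k₁ k₁}
                       {B : Mat n₂ n₂} {R : Mat n₂ k₂} {T : Mat k₂ k₂} →
                       Intertwines A P S → Intertwines B R T →
                       Intertwines (normalᴹ A B) (P ⊗ R) (normalᴹ S T)
  intertwines-normal {P = P} {R = R} AP≈PS BR≈RT = intertwines-⊞
    (intertwines-⊞ (intertwines-⊗ AP≈PS (intertwines-I R))
                   (intertwines-⊗ (intertwines-I P) BR≈RT))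
    (intertwines-⊗ AP≈PS BR≈RT)

  PerfectStructure-resp : ∀ {n k} {M M' : Mat n n} {P : Mat n k} {S S' : Mat k k} →
                          M ≈ᴹ M' → S ≈ᴹ S' → PerfectStructure M P S → PerfectStructure M' P S'
  PerfectStructure-resp M≈M' S≈S' (dM , k≤n , MP≈PS) =
    Diagonalizable-resp M≈M' dM , k≤n ,
    ≈ᴹ-trans (⊡-cong (≈ᴹ-sym M≈M') ≈ᴹ-refl) (≈ᴹ-trans MP≈PS (⊡-cong ≈ᴹ-refl S≈S'))

  PerfectStructure-normal : ∀ {n₁ k₁ n₂ k₂} {A : Mat n₁ n₁} {P : Mat n₁ k₁} {S : Mat k₁ k₁}
                            {B : Mat n₂ n₂} {R : Mat n₂ k₂} {T : Mat k₂ k₂} →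
                            PerfectStructure A P S → PerfectStructure B R T →
                            PerfectStructure (normalᴹ A B) (P ⊗ R) (normalᴹ S T)
  PerfectStructure-normal (dA , k₁≤n₁ , AP≈PS) (dB , k₂≤n₂ , BR≈RT) =
    Diagonalizable-normal dA dB , *-mono-≤ k₁≤n₁ k₂≤n₂ , intertwines-normal AP≈PS BR≈RT

  ite-∧ : ∀ a b → ite a * ite b ≈ ite (a ∧ b)
  ite-∧ true  true  = *-identityˡ 1#
  ite-∧ true  false = zeroʳ 1#
  ite-∧ false b     = zeroˡ (ite b)

  -- With e = [i = i'], a = [i ~ i'], f = [j = j'], b = [j ~ j'], the three
  -- adjacency cases of G ⊠ H are mutually exclusive because a excludes e and
  -- b excludes f; so the indicator of their disjunction is the sum of indicators.
  ite-normal : ∀ e a f b → a ∧ e ≡ false → b ∧ f ≡ false →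
               (ite (a ∧ f) + ite (e ∧ b)) + ite (a ∧ b) ≈ ite ((e ∧ b) ∨ (a ∧ f) ∨ (a ∧ b))
  ite-normal e     true  f     true  ≡.refl ≡.refl = trans (+-cong (+-identityʳ 0#) refl) (+-identityˡ 1#)
  ite-normal e     true  true  false ≡.refl _      = trans (+-identityʳ _) (+-identityʳ 1#)
  ite-normal e     true  false false ≡.refl _      = trans (+-identityʳ _) (+-identityʳ 0#)
  ite-normal true  false f     true  _      ≡.refl = trans (+-identityʳ _) (+-identityˡ 1#)
  ite-normal false false f     true  _      ≡.refl = trans (+-identityʳ _) (+-identityʳ 0#)
  ite-normal true  false f     false _      _      = trans (+-identityʳ _) (+-identityʳ 0#)
  ite-normal false false f     false _      _      = trans (+-identityʳ _) (+-identityʳ 0#)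

  adjMat-⊠ : ∀ {n₁ n₂} (G : Graph n₁) (H : Graph n₂) →
             adjMat (G ⊠ H) ≈ᴹ normalᴹ (adjMat G) (adjMat H)
  adjMat-⊠ {n₁} {n₂} G H x y = sym (trans
    (+-cong (+-cong (ite-∧ a f) (ite-∧ e b)) (ite-∧ a b))
    (ite-normal e a f b (adj-∧-=ᶠ G i i') (adj-∧-=ᶠ H j j')))
    where
      i = proj₁ (remQuot {n₁} n₂ x); i' = proj₁ (remQuot {n₁} n₂ y)
      j = proj₂ (remQuot {n₁} n₂ x); j' = proj₂ (remQuot {n₁} n₂ y)
      e = i =ᶠ i'; a = adj G i i'; f = j =ᶠ j'; b = adj H j j'

theorem4 : {c ℓ : Level} (𝕂 : CommutativeRing c ℓ) →
    let open Matrices 𝕂 in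
    {n₁ n₂ k₁ k₂ : ℕ} (G : Graph n₁) (H : Graph n₂)
    (P : Mat n₁ k₁) (S : Mat k₁ k₁) (R : Mat n₂ k₂) (T : Mat k₂ k₂) →
    PerfectStructure (adjMat G) P S →
    PerfectStructure (adjMat H) R T →
    (adjMat (G ⊠ H) ≈ᴹ
    (((adjMat G ⊗ I n₂) ⊞ (I n₁ ⊗ adjMat H)) ⊞ (adjMat G ⊗ adjMat H)))
    × PerfectStructure (adjMat (G ⊠ H)) (P ⊗ R)
    (((I k₁ ⊗ T) ⊞ (S ⊗ I k₂)) ⊞ (S ⊗ T))
theorem4 𝕂 G H P S R T perfectG perfectH =
  adjMat-⊠ G H ,
  PerfectStructure-resp (≈ᴹ-sym (adjMat-⊠ G H))
                        (normalᴹ-swap S T)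
                        (PerfectStructure-normal perfectG perfectH)
  where open Matrices 𝕂; open Kronecker 𝕂
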